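{- For any two positive integers $k,l$, $\eta(k,l)\geq \eta(k,l+1)$.
   Context: All graphs are finite and simple. The odd-girth of a graph is the length of its shortest odd cycle. $C_n$ denotes the cycle of length $n$. A homomorphism from $G$ to $H$ is a map $V(G)\to V(H)$ sending adjacent vertices to adjacent vertices. For positive integers $k,l$, $\eta(k,l)$ denotes the smallest number of vertices of a graph of odd-girth $2k+1$ that admits no homomorphism to $C_{2l+1}$. -}

module Defs where

open import Data.Nat using (ℕ; zero; suc; _+_; _*_; _≤_; _<_)
open import Data.Fin using (Fin; toℕ)
open import Data.Product using (Σ; _×_; _,_)
open import Data.Sum using (_⊎_)
open import Relation.Nullary using (¬_)
open import Relation.Binary.PropositionalEquality using (_≡_)
open import Function.Definitions using (Injective)

record Graph : Set₁ where
  field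
    n   : ℕ
    Adj : Fin n → Fin n → Set

open Graph public

IsSimple : Graph → Set
IsSimple G = (∀ u v → Adj G u v → Adj G v u) × (∀ u → ¬ Adj G u u)

Odd : ℕ → Set
Odd m = Σ ℕ λ j → m ≡ suc (2 * j)

CycNext : (m : ℕ) → Fin m → Fin m → Set
CycNext m i j = (suc (toℕ i) ≡ toℕ j) ⊎ ((suc (toℕ i) ≡ m) × (toℕ j ≡ 0))

CycEdge : (m : ℕ) → Fin m → Fin m → Set
CycEdge m i j = CycNext m i j ⊎ CycNext m j i

HasCycle : Graph → ℕ → Set
HasCycle G m =
  (3 ≤ m) × Σ (Fin m → Fin (n G)) λ c →
    Injective _≡_ _≡_ c × (∀ i j → CycNext m i j → Adj G (c i) (c j))

OddGirth : Graph → ℕ → Set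
OddGirth G g = Odd g × HasCycle G g × (∀ m → Odd m → m < g → ¬ HasCycle G m)

HomToCycle : Graph → ℕ → Set
HomToCycle G m =
  Σ (Fin (n G) → Fin m) λ f → ∀ u v → Adj G u v → CycEdge m (f u) (f v)

-- G is a witness for η(k,l): simple, odd-girth 2k+1, no homomorphism to C_{2l+1}.
-- η(k,l) is the least number of vertices of such a witness.
Witness : ℕ → ℕ → Graph → Set
Witness k l G =
  IsSimple G × OddGirth G (2 * k + 1) × ¬ HomToCycle G (2 * l + 1)

-- Folding the two vertices m, m+1 of C_{m+2} back onto m-2, m-1 is a homomorphism
-- C_{m+2} → C_m, so any graph with no homomorphism to C_{2l+1} has none to C_{2l+3}
-- either; a witness for η(k,l) is therefore itself a witness for η(k,l+1).
module Submission where

open import Defs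
open import Data.Nat using (ℕ; zero; suc; _+_; _*_; _∸_; _≤_; _<_; _<?_; s≤s; z≤n)
open import Data.Nat.Properties
  using (≤-refl; ≤-antisym; <-trans; <-irrefl; n<1+n; m≤n⇒m≤n+o; *-monoʳ-≤; ≮⇒≥; suc-injective; +-comm)
open import Data.Nat.Solver using (module +-*-Solver)
open import Data.Fin using (Fin; toℕ; fromℕ<)
open import Data.Fin.Properties using (toℕ<n; toℕ-fromℕ<)
open import Data.Product using (Σ; _×_; _,_)
open import Data.Sum using (_⊎_; inj₁; inj₂; swap)
open import Data.Empty using (⊥-elim)
open import Function using (_∘_)
open import Relation.Nullary using (¬_; yes; no)
open import Relation.Binary.PropositionalEquality using (_≡_; refl; sym; cong; subst; subst₂)

-- CycNext m i j is definitionally NextN m (toℕ i) (toℕ j).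
NextN : ℕ → ℕ → ℕ → Set
NextN m a b = (suc a ≡ b) ⊎ ((suc a ≡ m) × (b ≡ 0))

EdgeN : ℕ → ℕ → ℕ → Set
EdgeN m a b = NextN m a b ⊎ NextN m b a

CycleHom : (m m′ : ℕ) → (Fin m → Fin m′) → Set
CycleHom m m′ f = ∀ i j → CycEdge m i j → CycEdge m′ (f i) (f j)

homToCycle-∘ : ∀ {m m′} (G : Graph) (f : Fin m → Fin m′) → CycleHom m m′ f →
  HomToCycle G m → HomToCycle G m′
homToCycle-∘ G f f-hom (h , h-hom) = f ∘ h , λ u v uv → f-hom (h u) (h v) (h-hom u v uv)

module Fold (r : ℕ) where

  m : ℕ
  m = suc (suc r)

  foldℕ : ℕ → ℕ
  foldℕ x with x <? m
  ... | yes _ = x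
  ... | no _  = x ∸ 2

  foldℕ-< : ∀ x → x < m + 2 → foldℕ x < m
  foldℕ-< x x<m+2 with x <? m
  ... | yes x<m = x<m
  ... | no x≮m  = minus-two (≮⇒≥ x≮m) x<m+2
    where
    minus-two : ∀ {x} → m ≤ x → x < m + 2 → x ∸ 2 < m
    minus-two {suc (suc x)} _ (s≤s (s≤s x<r+2)) = subst (x <_) (+-comm r 2) x<r+2
    minus-two {suc zero} (s≤s ()) _

  foldℕ-next : ∀ a b → NextN (m + 2) a b → EdgeN m (foldℕ a) (foldℕ b)
  foldℕ-next a .(suc a) (inj₁ refl) with a <? m | suc a <? m
  ... | yes _   | yes _    = inj₁ (inj₁ refl)
  -- the edge (m-1, m) is sent to (m-1, m-2), traversed backwards
  ... | yes a<m | no 1+a≮m with ≤-antisym a<m (≮⇒≥ 1+a≮m)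
  ...   | refl = inj₂ (inj₁ refl)
  foldℕ-next a _ (inj₁ refl) | no a≮m | yes 1+a<m = ⊥-elim (a≮m (<-trans (n<1+n a) 1+a<m))
  foldℕ-next (suc (suc a)) _ (inj₁ refl) | no _ | no _ = inj₁ (inj₁ refl)
  foldℕ-next (suc zero) _ (inj₁ refl) | no 1≮m | no _ = ⊥-elim (1≮m (s≤s (s≤s z≤n)))
  foldℕ-next zero _ (inj₁ refl) | no 0≮m | no _ = ⊥-elim (0≮m (s≤s z≤n))
  foldℕ-next a b (inj₂ (1+a≡m+2 , refl)) with suc-injective 1+a≡m+2
  ... | refl with a <? m
  ...   | yes a<m = ⊥-elim (<-irrefl refl (<-trans 1+m<m (n<1+n m)))
    where
    1+m<m : suc m < m
    1+m<m = subst (_< m) (cong suc (+-comm r 2)) a<m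
  ...   | no _ = inj₁ (inj₂ (cong (suc ∘ (_∸ 1)) (+-comm r 2) , refl))

  fold : Fin (m + 2) → Fin m
  fold i = fromℕ< (foldℕ-< (toℕ i) (toℕ<n i))

  toℕ-fold : ∀ i → toℕ (fold i) ≡ foldℕ (toℕ i)
  toℕ-fold i = toℕ-fromℕ< (foldℕ-< (toℕ i) (toℕ<n i))

  fold-edge : ∀ i j → CycNext (m + 2) i j → CycEdge m (fold i) (fold j)
  fold-edge i j ij with foldℕ-next (toℕ i) (toℕ j) ij
  ... | inj₁ fw = inj₁ (subst₂ (NextN m) (sym (toℕ-fold i)) (sym (toℕ-fold j)) fw)
  ... | inj₂ bw = inj₂ (subst₂ (NextN m) (sym (toℕ-fold j)) (sym (toℕ-fold i)) bw)

  fold-hom : CycleHom (m + 2) m fold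
  fold-hom i j (inj₁ ij) = fold-edge i j ij
  fold-hom i j (inj₂ ji) = swap (fold-edge j i ji)

homToCycle-shrink : ∀ {m} (G : Graph) → 2 ≤ m → HomToCycle G (m + 2) → HomToCycle G m
homToCycle-shrink {suc (suc r)} G (s≤s (s≤s z≤n)) = homToCycle-∘ G fold fold-hom
  where open Fold r

2*[l+1]+1≡2*l+1+2 : ∀ l → 2 * (l + 1) + 1 ≡ 2 * l + 1 + 2
2*[l+1]+1≡2*l+1+2 = solve 1 (λ l → con 2 :* (l :+ con 1) :+ con 1 := con 2 :* l :+ con 1 :+ con 2) refl
  where open +-*-Solver

mainTheorem3 : (k l : ℕ) → 1 ≤ k → 1 ≤ l → (G : Graph) → Witness k l G →
    Σ Graph (λ H → Witness k (l + 1) H × n H ≤ n G)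
mainTheorem3 k l _ 1≤l G (simple , oddGirth , noHom) =
  G , (simple , oddGirth , noHom′) , ≤-refl
  where
  2≤2l+1 : 2 ≤ 2 * l + 1
  2≤2l+1 = m≤n⇒m≤n+o 1 (*-monoʳ-≤ 2 1≤l)

  noHom′ : ¬ HomToCycle G (2 * (l + 1) + 1)
  noHom′ = noHom ∘ homToCycle-shrink G 2≤2l+1 ∘ subst (HomToCycle G) (2*[l+1]+1≡2*l+1+2 l)
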